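{- Let $G$ be a digraph satisfying (N1), (N2) and (N3). Then $(G,\sigma)$ is a qBMG for every proper 2-coloring $\sigma$ of $G$.
   Context: $G$ is a finite simple digraph; $N(x)$ is its out-neighbourhood and $N(A)=\bigcup_{x\in A}N(x)$. (N1): for all $x,y\in V(G)$, if $x\notin N(y)$ and $y\notin N(x)$ then $N(x)\cap N(N(y))=N(y)\cap N(N(x))=\emptyset$; (N2): $N(N(N(x)))\subseteq N(x)$; (N3): $N(x)\cap N(y)\ne\emptyset$ implies $N(x)\subseteq N(y)$ or $N(y)\subseteq N(x)$. A proper 2-coloring assigns one of two colors to each vertex such that adjacent vertices receive different colors. All rooted trees are phylogenetic; $v\preceq_T u$ means $u$ is on the path from root $\rho_T$ to $v$. In leaf-colored $(T,\sigma)$, $y$ is a best match of $x$ if $\sigma(x)\ne\sigma(y)$ and $\mathrm{lca}_T(x,y)\preceq_T\mathrm{lca}_T(x,y')$ for all leaves $y'$ with $\sigma(y')=\sigma(y)$. A truncation map $u\colon L(T)\times S\to V(T)$ (with $\sigma(L(T))\subseteq S$) sends $(x,s)$ to a vertex on the path from $\rho_T$ to $x$ with $u(x,\sigma(x))=x$; $y$ is a quasi-best match of $x$ if it is a best match and $\mathrm{lca}_T(x,y)\preceq_T u(x,\sigma(y))$. $(G,\sigma)$ is a qBMG if it equals the digraph on $L(T)$ with arcs $xy$ for quasi-best matches $y$ of $x$, for some $(T,\sigma,u)$. -}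

module Defs where

open import Data.Nat using (ℕ; zero; suc)
open import Data.Fin using (Fin)
open import Data.Bool using (Bool; true; false)
open import Data.Product using (Σ; ∃; ∃-syntax; _×_; _,_)
open import Data.Sum using (_⊎_)
open import Data.Empty using (⊥)
open import Relation.Nullary using (¬_)
open import Relation.Binary.PropositionalEquality using (_≡_; _≢_)

record Digraph (n : ℕ) : Set where
  field
    arc     : Fin n → Fin n → Bool
    noLoops : ∀ x → arc x x ≡ false

open Digraph public

Arc : ∀ {n} → Digraph n → Fin n → Fin n → Set
Arc G x y = arc G x y ≡ true

Arc² : ∀ {n} → Digraph n → Fin n → Fin n → Set
Arc² G x z = ∃[ w ] (Arc G x w × Arc G w z)

Arc³ : ∀ {n} → Digraph n → Fin n → Fin n → Set
Arc³ G x z = ∃[ a ] ∃[ b ] (Arc G x a × Arc G a b × Arc G b z)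

N1 : ∀ {n} → Digraph n → Set
N1 G = ∀ x y → ¬ Arc G y x → ¬ Arc G x y →
         (∀ z → Arc G x z → ¬ Arc² G y z) × (∀ z → Arc G y z → ¬ Arc² G x z)

N2 : ∀ {n} → Digraph n → Set
N2 G = ∀ x z → Arc³ G x z → Arc G x z

N3 : ∀ {n} → Digraph n → Set
N3 G = ∀ x y → (∃[ z ] (Arc G x z × Arc G y z)) →
         (∀ z → Arc G x z → Arc G y z) ⊎ (∀ z → Arc G y z → Arc G x z)

Proper2Coloring : ∀ {n} → Digraph n → (Fin n → Bool) → Set
Proper2Coloring G σ = ∀ x y → Arc G x y → σ x ≢ σ y

-- Rooted phylogenetic trees on the vertex set Fin m,
-- given by a parent map (the root is its own parent) such that every
-- vertex reaches the root by iterating the parent map.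

iter : ∀ {A : Set} → (A → A) → ℕ → A → A
iter f zero    a = a
iter f (suc k) a = f (iter f k a)

record RootedTree : Set where
  field
    m       : ℕ
    root    : Fin m
    parent  : Fin m → Fin m
    parent-root : parent root ≡ root
    reach   : ∀ v → ∃[ k ] (iter parent k v ≡ root)

  _⪯_ : Fin m → Fin m → Set
  v ⪯ u = ∃[ k ] (iter parent k v ≡ u)

  Child : Fin m → Fin m → Set
  Child w v = parent w ≡ v × w ≢ v

  IsLeaf : Fin m → Set
  IsLeaf v = ∀ w → ¬ Child w v

  IsLCA : Fin m → Fin m → Fin m → Set
  IsLCA x y w = x ⪯ w × y ⪯ w × (∀ w' → x ⪯ w' → y ⪯ w' → w ⪯ w')

open RootedTree public

Phylogenetic : RootedTree → Set
Phylogenetic T = ∀ v → ¬ IsLeaf T v →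
  ∃[ w₁ ] ∃[ w₂ ] (Child T w₁ v × Child T w₂ v × w₁ ≢ w₂)

-- ℓ identifies Fin n with the leaf set L(T): injective with image = leaves
LeafLabelling : (n : ℕ) → (T : RootedTree) → (Fin n → Fin (m T)) → Set
LeafLabelling n T ℓ =
  (∀ x y → ℓ x ≡ ℓ y → x ≡ y) ×
  (∀ x → IsLeaf T (ℓ x)) ×
  (∀ v → IsLeaf T v → ∃[ x ] (ℓ x ≡ v))

module _ {n : ℕ} (T : RootedTree) (ℓ : Fin n → Fin (m T)) (σ : Fin n → Bool) where

  BestMatch : Fin n → Fin n → Set
  BestMatch x y = σ x ≢ σ y ×
    (∀ y' → σ y' ≡ σ y → ∀ a b →
       IsLCA T (ℓ x) (ℓ y) a → IsLCA T (ℓ x) (ℓ y') b → _⪯_ T a b)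

  TruncationMap : (Fin n → Bool → Fin (m T)) → Set
  TruncationMap u = (∀ x s → _⪯_ T (ℓ x) (u x s)) × (∀ x → u x (σ x) ≡ ℓ x)

  QuasiBestMatch : (Fin n → Bool → Fin (m T)) → Fin n → Fin n → Set
  QuasiBestMatch u x y = BestMatch x y ×
    (∀ a → IsLCA T (ℓ x) (ℓ y) a → _⪯_ T a (u x (σ y)))

IsQBMG : ∀ {n} → Digraph n → (Fin n → Bool) → Set
IsQBMG {n} G σ =
  Σ RootedTree λ T → Phylogenetic T ×
  Σ (Fin n → Fin (m T)) λ ℓ → LeafLabelling n T ℓ ×
  Σ (Fin n → Bool → Fin (m T)) λ u → TruncationMap T ℓ σ u ×
  (∀ x y → (Arc G x y → QuasiBestMatch T ℓ σ u x y)
         × (QuasiBestMatch T ℓ σ u x y → Arc G x y))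

{-# OPTIONS --safe #-}
-- For a non-sink w let C w = N(w) ∪ {z | σ z = σ w, N(z) ⊆ N(w), and z is no sink
-- or z ∈ N(N(w))}. By (N1)–(N3) any two such sets that meet are nested, so with V
-- and the singletons they form a hierarchy, whose Hasse diagram is a phylogenetic
-- tree with leaf set V. Every cluster containing x and a vertex of colour ≠ σ x
-- contains N(x), so out-neighbours are best matches. Conversely, for a non-sink x
-- and y₀ ∈ N(x), a best match y of the other colour has lca(x,y) below
-- lca(x,y₀) ⊆ C x, and C x meets that colour only in N(x). So truncating the sinks
-- at themselves, and nothing else, makes the quasi-best matches exactly the arcs.
module Submission where

open import Defs
open import Data.Bool as Bool using (Bool; true)
open import Data.Bool.Properties using (¬-not)
open import Data.Empty using (⊥; ⊥-elim)
open import Data.Fin using (Fin; zero; suc)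
open import Data.Fin.Properties using (any?; all?; ¬∀⟶∃¬; _≟_)
open import Data.Fin.Subset using (Subset; ⊤; ⁅_⁆; _∈_; _⊆_; _⊂_; ∣_∣; Nonempty)
open import Data.Fin.Subset.Induction using (⊃-wellFounded)
open import Data.Fin.Subset.Properties
  using (_∈?_; _⊂?_; ∈⊤; x∈⁅x⁆; x∈⁅y⁆⇒x≡y; ⊆-antisym; p⊂q⇒∣p∣<∣q∣)
open import Data.List using (List; _∷_; _++_; map; filter; allFin; length; lookup; deduplicate)
open import Data.List.Membership.Propositional using () renaming (_∈_ to _∈ᴸ_)
open import Data.List.Membership.Propositional.Properties
  using (∈-lookup; deduplicate-∈⇔; ∈-++⁺ˡ; ∈-++⁺ʳ; ∈-++⁻; ∈-map⁺; ∈-map⁻; ∈-filter⁺; ∈-filter⁻; ∈-allFin)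
open import Data.List.Relation.Unary.All as All using ()
open import Data.List.Relation.Unary.AllPairs using (_∷_)
open import Data.List.Relation.Unary.Any using (here; there; index)
open import Data.List.Relation.Unary.Any.Properties using (lookup-index)
open import Data.List.Relation.Unary.Unique.Propositional using (Unique)
open import Data.List.Relation.Unary.Unique.DecPropositional.Properties using (deduplicate-!)
open import Data.Nat using (ℕ; zero; suc; _≤_; z≤n; _≤?_)
open import Data.Nat.Properties using (≤-refl; ≤-trans; ≰⇒>; <⇒≱)
open import Data.Product using (∃; ∃-syntax; _×_; _,_; proj₁; proj₂)
open import Data.Sum as Sum using (_⊎_; inj₁; inj₂)
open import Data.Vec using (tabulate)
open import Data.Vec.Properties using (lookup∘tabulate; lookup⇒[]=; []=⇒lookup; ≡-dec)
open import Function using (_∘_)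
open import Function.Bundles using (Equivalence)
open import Induction.WellFounded using (Acc; acc)
open import Relation.Binary.PropositionalEquality using (_≡_; _≢_; refl; sym; trans; cong; subst; ≢-sym)
open import Relation.Nullary using (¬_; Dec; yes; no; does; ¬?)
open import Relation.Nullary.Decidable using (dec-true; toSum; _×-dec_; _⊎-dec_; _→-dec_)
open import Relation.Unary using (Decidable)

least-by : ∀ {k} {P : Fin k → Set} → Decidable P → (f : Fin k → ℕ) →
           ∃ P → ∃[ j ] (P j × (∀ i → P i → f j ≤ f i))
least-by {P = P} P? f (i , pi) = descend (f i) i pi ≤-refl
  where
  descend : ∀ b i → P i → f i ≤ b → ∃[ j ] (P j × (∀ i → P i → f j ≤ f i))
  descend zero    i pi fi≤b = i , pi , λ _ _ → ≤-trans fi≤b z≤n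
  descend (suc b) i pi fi≤b with any? (λ j → P? j ×-dec f j ≤? b)
  ... | yes (j , pj , fj≤b) = descend b j pj fj≤b
  ... | no ∄j = i , pi , λ j pj → ≤-trans fi≤b (≰⇒> (λ fj≤b → ∄j (j , pj , fj≤b)))

lookup-injective : ∀ {A : Set} {xs : List A} → Unique xs →
                   ∀ {i j} → lookup xs i ≡ lookup xs j → i ≡ j
lookup-injective (_ ∷ _)          {zero}  {zero}  _ = refl
lookup-injective (x∉xs ∷ _)       {zero}  {suc j} e = ⊥-elim (All.lookup x∉xs (∈-lookup j) e)
lookup-injective (x∉xs ∷ _)       {suc i} {zero}  e = ⊥-elim (All.lookup x∉xs (∈-lookup i) (sym e))
lookup-injective (_ ∷ unique-xs) {suc i} {suc j} e = cong suc (lookup-injective unique-xs e)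

≢-≢⇒≡ : ∀ {a b c : Bool} → a ≢ b → c ≢ a → c ≡ b
≢-≢⇒≡ a≢b c≢a = trans (¬-not c≢a) (sym (¬-not (≢-sym a≢b)))

iter-suc′ : ∀ {A : Set} (f : A → A) k a → iter f k (f a) ≡ iter f (suc k) a
iter-suc′ f zero    a = refl
iter-suc′ f (suc k) a = cong f (iter-suc′ f k a)

module _ {n : ℕ} where

  _≟ˢ_ : (p q : Subset n) → Dec (p ≡ q)
  _≟ˢ_ = ≡-dec Bool._≟_

  ⊆∧⊄⇒⊇ : {p q : Subset n} → p ⊆ q → ¬ p ⊂ q → q ⊆ p
  ⊆∧⊄⇒⊇ {p} p⊆q p⊄q {x} x∈q with x ∈? p
  ... | yes x∈p = x∈p
  ... | no  x∉p = ⊥-elim (p⊄q (p⊆q , x , x∈q , x∉p))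

  ∈⁅⁆⇒⊆ : {x y : Fin n} {p : Subset n} → x ∈ ⁅ y ⁆ → x ∈ p → ⁅ y ⁆ ⊆ p
  ∈⁅⁆⇒⊆ {y = y} x∈⁅y⁆ x∈p z∈⁅y⁆ =
    subst (_∈ _) (trans (x∈⁅y⁆⇒x≡y y x∈⁅y⁆) (sym (x∈⁅y⁆⇒x≡y y z∈⁅y⁆))) x∈p

  ⟦_⟧ : {P : Fin n → Set} → Decidable P → Subset n
  ⟦ P? ⟧ = tabulate (does ∘ P?)

  ∈⟦⟧⁺ : {P : Fin n → Set} (P? : Decidable P) {x : Fin n} → P x → x ∈ ⟦ P? ⟧
  ∈⟦⟧⁺ P? {x} px = lookup⇒[]= x _ (trans (lookup∘tabulate (does ∘ P?) x) (dec-true (P? x) px))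

  ∈⟦⟧⁻ : {P : Fin n → Set} (P? : Decidable P) {x : Fin n} → x ∈ ⟦ P? ⟧ → P x
  ∈⟦⟧⁻ P? {x} x∈ with P? x | trans (sym (lookup∘tabulate (does ∘ P?) x)) ([]=⇒lookup x∈)
  ... | yes px | _ = px
  ... | no _   | ()

record IsHierarchy {n : ℕ} (H : List (Subset n)) : Set where
  field
    ⊤∈H      : ⊤ ∈ᴸ H
    ⁅⁆∈H     : ∀ x → ⁅ x ⁆ ∈ᴸ H
    nonempty : ∀ {S} → S ∈ᴸ H → Nonempty S
    nested   : ∀ {S T x} → S ∈ᴸ H → T ∈ᴸ H → x ∈ S → x ∈ T → S ⊆ T ⊎ T ⊆ S

module HasseTree {n : ℕ} {H : List (Subset n)} (hierarchy : IsHierarchy H) where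
  open IsHierarchy hierarchy

  size : ℕ
  size = length (deduplicate _≟ˢ_ H)

  cluster : Fin size → Subset n
  cluster = lookup (deduplicate _≟ˢ_ H)

  cluster∈H : ∀ v → cluster v ∈ᴸ H
  cluster∈H v = Equivalence.from (deduplicate-∈⇔ _≟ˢ_) (∈-lookup v)

  vertex : ∀ {S} → S ∈ᴸ H → ∃[ v ] (cluster v ≡ S)
  vertex {S} S∈H = index S∈D , sym (lookup-index S∈D)
    where
    S∈D : S ∈ᴸ deduplicate _≟ˢ_ H
    S∈D = Equivalence.to (deduplicate-∈⇔ _≟ˢ_) S∈H

  cluster-injective : ∀ {v w} → cluster v ≡ cluster w → v ≡ w
  cluster-injective = lookup-injective (deduplicate-! _≟ˢ_ H)

  ≤-size⇒⊆ : ∀ {v w x} → x ∈ cluster v → x ∈ cluster w →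
             ∣ cluster v ∣ ≤ ∣ cluster w ∣ → cluster v ⊆ cluster w
  ≤-size⇒⊆ {v} {w} x∈v x∈w v≤w with nested (cluster∈H v) (cluster∈H w) x∈v x∈w
  ... | inj₁ v⊆w = v⊆w
  ... | inj₂ w⊆v with cluster w ⊂? cluster v
  ...   | yes w⊂v = ⊥-elim (<⇒≱ (p⊂q⇒∣p∣<∣q∣ w⊂v) v≤w)
  ...   | no  w⊄v = ⊆∧⊄⇒⊇ w⊆v w⊄v

  IsParent : Fin size → Fin size → Set
  IsParent v p = (cluster v ⊂ cluster p × (∀ w → cluster v ⊂ cluster w → cluster p ⊆ cluster w))
               ⊎ (p ≡ v × (∀ w → ¬ cluster v ⊂ cluster w))

  parent-exists : ∀ v → ∃ (IsParent v)
  parent-exists v with any? (λ w → cluster v ⊂? cluster w)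
  ... | no ∄w = v , inj₂ (refl , λ w v⊂w → ∄w (w , v⊂w))
  ... | yes ∃w with least-by (λ w → cluster v ⊂? cluster w) (∣_∣ ∘ cluster) ∃w
  ...   | p , v⊂p , least = p , inj₁ (v⊂p , λ w v⊂w →
            ≤-size⇒⊆ (proj₁ v⊂p x∈v) (proj₁ v⊂w x∈v) (least w v⊂w))
    where
    x∈v : proj₁ (nonempty (cluster∈H v)) ∈ cluster v
    x∈v = proj₂ (nonempty (cluster∈H v))

  parentᴴ : Fin size → Fin size
  parentᴴ v = proj₁ (parent-exists v)

  isParent : ∀ v → IsParent v (parentᴴ v)
  isParent v = proj₂ (parent-exists v)

  cluster⊆parent : ∀ v → cluster v ⊆ cluster (parentᴴ v)
  cluster⊆parent v with isParent v
  ... | inj₁ (v⊂p , _) = proj₁ v⊂p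
  ... | inj₂ (p≡v , _) = subst (λ p → cluster v ⊆ cluster p) (sym p≡v) (λ x∈v → x∈v)

  _≼_ : Fin size → Fin size → Set
  v ≼ u = ∃[ k ] (iter parentᴴ k v ≡ u)

  ≼⇒⊆ : ∀ {v u} → v ≼ u → cluster v ⊆ cluster u
  ≼⇒⊆ (zero  , refl) x∈v = x∈v
  ≼⇒⊆ (suc k , refl) x∈v = cluster⊆parent _ (≼⇒⊆ (k , refl) x∈v)

  ⊆⇒≼ : ∀ {v u} → cluster v ⊆ cluster u → v ≼ u
  ⊆⇒≼ {v} = climb (⊃-wellFounded (cluster v))
    where
    climb : ∀ {v u} → Acc _ (cluster v) → cluster v ⊆ cluster u → v ≼ u
    climb {v} {u} (acc larger) v⊆u with cluster v ⊂? cluster u | isParent v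
    ... | no v⊄u | _ = 0 , cluster-injective (⊆-antisym v⊆u (⊆∧⊄⇒⊇ v⊆u v⊄u))
    ... | yes v⊂u | inj₂ (_ , maximal) = ⊥-elim (maximal u v⊂u)
    ... | yes v⊂u | inj₁ (v⊂p , least) with climb (larger v⊂p) (least u v⊂u)
    ...   | k , p↑k≡u = suc k , trans (sym (iter-suc′ parentᴴ k v)) p↑k≡u

  rootᴴ : Fin size
  rootᴴ = proj₁ (vertex ⊤∈H)

  ∈root : ∀ {x} → x ∈ cluster rootᴴ
  ∈root = subst (_ ∈_) (sym (proj₂ (vertex ⊤∈H))) ∈⊤

  parentᴴ-root : parentᴴ rootᴴ ≡ rootᴴ
  parentᴴ-root with isParent rootᴴ
  ... | inj₂ (p≡root , _)              = p≡root
  ... | inj₁ ((_ , _ , _ , x∉root) , _) = ⊥-elim (x∉root ∈root)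

  ≼-root : ∀ v → v ≼ rootᴴ
  ≼-root v = ⊆⇒≼ (λ _ → ∈root)

  tree : RootedTree
  tree = record
    { m = size ; root = rootᴴ ; parent = parentᴴ ; parent-root = parentᴴ-root ; reach = ≼-root }

  leaf : Fin n → Fin size
  leaf x = proj₁ (vertex (⁅⁆∈H x))

  x∈leaf : ∀ x → x ∈ cluster (leaf x)
  x∈leaf x = subst (x ∈_) (sym (proj₂ (vertex (⁅⁆∈H x)))) (x∈⁅x⁆ x)

  ∈leaf⇒≡ : ∀ {x y} → y ∈ cluster (leaf x) → y ≡ x
  ∈leaf⇒≡ {x} y∈ = x∈⁅y⁆⇒x≡y x (subst (_ ∈_) (proj₂ (vertex (⁅⁆∈H x))) y∈)

  leaf≼⇒∈ : ∀ {x v} → leaf x ≼ v → x ∈ cluster v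
  leaf≼⇒∈ {x} x≼v = ≼⇒⊆ x≼v (x∈leaf x)

  ∈⇒leaf≼ : ∀ {x v} → x ∈ cluster v → leaf x ≼ v
  ∈⇒leaf≼ x∈v = ⊆⇒≼ (λ y∈ → subst (_∈ cluster _) (sym (∈leaf⇒≡ y∈)) x∈v)

  child⊂ : ∀ {w v} → Child tree w v → cluster w ⊂ cluster v
  child⊂ {w} (refl , w≢p) with isParent w
  ... | inj₁ (w⊂p , _) = w⊂p
  ... | inj₂ (p≡w , _) = ⊥-elim (w≢p (sym p≡w))

  child-above : ∀ k {a b} → iter parentᴴ k a ≡ b → a ≢ b →
                ∃[ c ] (Child tree c b × cluster a ⊆ cluster c)
  child-above zero        a≡b a≢b = ⊥-elim (a≢b a≡b)
  child-above (suc k) {a} {b} e a≢b with iter parentᴴ k a ≟ b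
  ... | yes e′ = child-above k e′ a≢b
  ... | no  c≢b = iter parentᴴ k a , (e , c≢b) , ≼⇒⊆ (k , refl)

  leaf-isLeaf : ∀ x → IsLeaf tree (leaf x)
  leaf-isLeaf x w w◁leaf with child⊂ w◁leaf | nonempty (cluster∈H w)
  ... | w⊆leaf , y , y∈leaf , y∉w | z , z∈w =
        y∉w (subst (_∈ cluster w) (trans (∈leaf⇒≡ (w⊆leaf z∈w)) (sym (∈leaf⇒≡ y∈leaf))) z∈w)

  isLeaf⇒leaf : ∀ v → IsLeaf tree v → ∃[ x ] (leaf x ≡ v)
  isLeaf⇒leaf v v-leaf with nonempty (cluster∈H v)
  ... | x , x∈v with leaf x ≟ v | ∈⇒leaf≼ x∈v
  ...   | yes x≡v | _       = x , x≡v
  ...   | no  x≢v | k , x↑k = ⊥-elim (v-leaf _ (proj₁ (proj₂ (child-above k x↑k x≢v))))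

  phylogenetic : Phylogenetic tree
  phylogenetic v v-inner with any? (λ w → (parentᴴ w ≟ v) ×-dec ¬? (w ≟ v))
  ... | no ∄child = ⊥-elim (v-inner (λ w w◁v → ∄child (w , w◁v)))
  ... | yes (c₁ , c₁◁v) with child⊂ c₁◁v
  ...   | _ , y , y∈v , y∉c₁ with ∈⇒leaf≼ y∈v
  ...     | k , y↑k with child-above k y↑k (λ y≡v → v-inner (subst (IsLeaf tree) y≡v (leaf-isLeaf y)))
  ...       | c₂ , c₂◁v , y⊆c₂ = c₁ , c₂ , c₁◁v , c₂◁v ,
                λ c₁≡c₂ → y∉c₁ (subst (λ c → y ∈ cluster c) (sym c₁≡c₂) (y⊆c₂ (x∈leaf y)))

  leafLabelling : LeafLabelling n tree leaf
  leafLabelling =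
    (λ x y e → ∈leaf⇒≡ (subst (λ v → x ∈ cluster v) e (x∈leaf x))) , leaf-isLeaf , isLeaf⇒leaf

  lca-exists : ∀ x y → ∃[ a ] (IsLCA tree (leaf x) (leaf y) a)
  lca-exists x y
    with least-by (λ v → (x ∈? cluster v) ×-dec (y ∈? cluster v)) (∣_∣ ∘ cluster) (rootᴴ , ∈root , ∈root)
  ... | a , (x∈a , y∈a) , least = a , ∈⇒leaf≼ x∈a , ∈⇒leaf≼ y∈a , λ w x≼w y≼w →
        ⊆⇒≼ (≤-size⇒⊆ x∈a (leaf≼⇒∈ x≼w) (least w (leaf≼⇒∈ x≼w , leaf≼⇒∈ y≼w)))

module ClusterTree {n : ℕ} (G : Digraph (suc n)) (n1 : N1 G) (n2 : N2 G) (n3 : N3 G)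
  (σ : Fin (suc n) → Bool) (proper : Proper2Coloring G σ) where

  V : Set
  V = Fin (suc n)

  _⟶_ : V → V → Set
  _⟶_ = Arc G

  _⟶?_ : ∀ x y → Dec (x ⟶ y)
  x ⟶? y = arc G x y Bool.≟ true

  NonSink : V → Set
  NonSink x = ∃ (x ⟶_)

  nonSink? : ∀ x → Dec (NonSink x)
  nonSink? x = any? (x ⟶?_)

  _⊆ᴺ_ : V → V → Set
  x ⊆ᴺ y = ∀ t → x ⟶ t → y ⟶ t

  ⟶³ : ∀ {w x y z} → w ⟶ x → x ⟶ y → y ⟶ z → w ⟶ z
  ⟶³ wx xy yz = n2 _ _ (_ , _ , wx , xy , yz)

  ⟶²⇒⊆ᴺ : ∀ {w x y} → w ⟶ x → x ⟶ y → y ⊆ᴺ w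
  ⟶²⇒⊆ᴺ wx xy _ = ⟶³ wx xy

  N1⇒adjacent : ∀ {x y t} → x ⟶ t → Arc² G y t → x ⟶ y ⊎ y ⟶ x
  N1⇒adjacent {x} {y} xt y⟶²t with x ⟶? y | y ⟶? x
  ... | yes xy | _      = inj₁ xy
  ... | no _   | yes yx = inj₂ yx
  ... | no ¬xy | no ¬yx = ⊥-elim (proj₁ (n1 x y ¬yx ¬xy) _ xt y⟶²t)

  Companion : V → V → Set
  Companion w z = σ z ≡ σ w × z ⊆ᴺ w × (NonSink z ⊎ Arc² G w z)

  InCluster : V → V → Set
  InCluster w z = w ⟶ z ⊎ Companion w z

  inCluster? : ∀ w z → Dec (InCluster w z)
  inCluster? w z = w ⟶? z ⊎-dec ((σ z Bool.≟ σ w) ×-dec all? (λ t → z ⟶? t →-dec w ⟶? t)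
                                   ×-dec (nonSink? z ⊎-dec any? (λ y → w ⟶? y ×-dec y ⟶? z)))

  _⊑_ : V → V → Set
  w ⊑ v = ∀ z → InCluster w z → InCluster v z

  ⊑-or-witness : ∀ w v → w ⊑ v ⊎ ∃[ z ] (InCluster w z × ¬ InCluster v z)
  ⊑-or-witness w v with all? (λ z → inCluster? w z →-dec inCluster? v z)
  ... | yes w⊑v = inj₁ w⊑v
  ... | no  w⋢v with ¬∀⟶∃¬ _ _ (λ z → inCluster? w z →-dec inCluster? v z) w⋢v
  ...   | z , z-escapes with inCluster? w z | inCluster? v z
  ...     | yes z∈w | no z∉v = inj₂ (z , z∈w , z∉v)
  ...     | no z∉w  | _      = ⊥-elim (z-escapes (⊥-elim ∘ z∉w))
  ...     | _       | yes z∈v = ⊥-elim (z-escapes (λ _ → z∈v))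

  self∈C : ∀ {w} → NonSink w → InCluster w w
  self∈C ns = inj₂ (refl , (λ _ wt → wt) , inj₁ ns)

  C-closed : ∀ {w x y} → InCluster w x → x ⟶ y → InCluster w y
  C-closed {w} {x} {y} (inj₁ wx) xy =
    inj₂ (≢-≢⇒≡ (≢-sym (proper w x wx)) (≢-sym (proper x y xy)) , ⟶²⇒⊆ᴺ wx xy , inj₂ (x , wx , xy))
  C-closed (inj₂ (_ , x⊆w , _)) xy = inj₁ (x⊆w _ xy)

  C⇒arc : ∀ {x y} → InCluster x y → σ y ≢ σ x → x ⟶ y
  C⇒arc (inj₁ xy)      _     = xy
  C⇒arc (inj₂ (same , _)) σy≢σx = ⊥-elim (σy≢σx same)

  ⊆ᴺ⇒⊑ : ∀ {w v} → w ⊆ᴺ v → σ w ≡ σ v → w ⊑ v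
  ⊆ᴺ⇒⊑ w⊆v _     z (inj₁ wz) = inj₁ (w⊆v z wz)
  ⊆ᴺ⇒⊑ w⊆v σw≡σv z (inj₂ (σz≡σw , z⊆w , why)) =
    inj₂ (trans σz≡σw σw≡σv , (λ t → w⊆v t ∘ z⊆w t) , Sum.map₂ (λ (y , wy , yz) → y , w⊆v y wy , yz) why)

  common-out⇒nested : ∀ {w v t} → σ w ≡ σ v → w ⟶ t → v ⟶ t → w ⊑ v ⊎ v ⊑ w
  common-out⇒nested σw≡σv wt vt =
    Sum.map (λ w⊆v → ⊆ᴺ⇒⊑ w⊆v σw≡σv) (λ v⊆w → ⊆ᴺ⇒⊑ v⊆w (sym σw≡σv)) (n3 _ _ (_ , wt , vt))

  nested-sameColour : ∀ {w v t} → σ w ≡ σ v → InCluster w t → InCluster v t → w ⊑ v ⊎ v ⊑ w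
  nested-sameColour same (inj₁ wt) (inj₁ vt) = common-out⇒nested same wt vt
  nested-sameColour same (inj₁ wt) (inj₂ (σt≡σv , _)) =
    ⊥-elim (proper _ _ wt (trans same (sym σt≡σv)))
  nested-sameColour same (inj₂ (σt≡σw , _)) (inj₁ vt) =
    ⊥-elim (proper _ _ vt (trans (sym same) (sym σt≡σw)))
  nested-sameColour same (inj₂ (_ , t⊆w , inj₁ (r , tr))) (inj₂ (_ , t⊆v , _)) =
    common-out⇒nested same (t⊆w r tr) (t⊆v r tr)
  nested-sameColour same (inj₂ (_ , t⊆w , inj₂ _)) (inj₂ (_ , t⊆v , inj₁ (r , tr))) =
    common-out⇒nested same (t⊆w r tr) (t⊆v r tr)
  nested-sameColour same (inj₂ (_ , _ , inj₂ (y , wy , yt))) (inj₂ (_ , _ , inj₂ v⟶²t))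
    with N1⇒adjacent yt v⟶²t
  ... | inj₁ yv = inj₂ (⊆ᴺ⇒⊑ (⟶²⇒⊆ᴺ wy yv) (sym same))
  ... | inj₂ vy = common-out⇒nested same wy vy

  companion-adjacent : ∀ {w x t} → x ⟶ t → Companion w t → x ⟶ w ⊎ w ⟶ x
  companion-adjacent xt (_ , _ , inj₂ w⟶²t) = N1⇒adjacent xt w⟶²t
  companion-adjacent xt (_ , t⊆w , inj₁ (r , tr)) = Sum.swap (N1⇒adjacent (t⊆w r tr) (_ , xt , tr))

  crossColour-adjacent : ∀ {w v t} → σ w ≢ σ v → InCluster w t → InCluster v t → w ⟶ v ⊎ v ⟶ w
  crossColour-adjacent {w} {v} {t} σw≢σv (inj₁ wt) (inj₁ vt) =
    ⊥-elim (proper v t vt (sym (≢-≢⇒≡ σw≢σv (≢-sym (proper w t wt)))))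
  crossColour-adjacent _ (inj₁ wt) (inj₂ c) = companion-adjacent wt c
  crossColour-adjacent _ (inj₂ c) (inj₁ vt) = Sum.swap (companion-adjacent vt c)
  crossColour-adjacent σw≢σv (inj₂ (σt≡σw , _)) (inj₂ (σt≡σv , _)) =
    ⊥-elim (σw≢σv (trans (sym σt≡σw) σt≡σv))

  Obstruction : V → V → Set
  Obstruction w v = w ⟶ v × ∃[ z ] (Companion w z × z ⟶ v × ¬ v ⟶ z)

  arc⇒⊑-or-obstruction : ∀ {w v} → σ w ≢ σ v → v ⟶ w → w ⊑ v ⊎ Obstruction w v
  arc⇒⊑-or-obstruction {w} {v} σw≢σv vw with ⊑-or-witness w v
  ... | inj₁ w⊑v = inj₁ w⊑v
  ... | inj₂ (z , inj₁ wz , z∉v) =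
        ⊥-elim (z∉v (inj₂ (≢-≢⇒≡ σw≢σv (≢-sym (proper w z wz)) , ⟶²⇒⊆ᴺ vw wz , inj₂ (w , vw , wz))))
  ... | inj₂ (z , inj₂ (_ , _ , inj₂ (p , wp , pz)) , z∉v) = ⊥-elim (z∉v (inj₁ (⟶³ vw wp pz)))
  ... | inj₂ (z , inj₂ c@(_ , z⊆w , inj₁ (r , zr)) , z∉v) with N1⇒adjacent zr (w , vw , z⊆w r zr)
  ...   | inj₁ zv = inj₂ (z⊆w v zv , z , c , zv , λ vz → z∉v (inj₁ vz))
  ...   | inj₂ vz = ⊥-elim (z∉v (inj₁ vz))

  no-mutual-obstruction : ∀ {w v} → Obstruction w v → Obstruction v w → ⊥
  no-mutual-obstruction (wv , z , (_ , z⊆w , _) , zv , ¬vz) (_ , z′ , (_ , z′⊆v , _) , z′w , ¬wz′)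
    with N1⇒adjacent zv (_ , z′w , wv)
  ... | inj₁ zz′ = ¬wz′ (z⊆w z′ zz′)
  ... | inj₂ z′z = ¬vz (z′⊆v z z′z)

  arc⇒nested : ∀ {w v} → σ w ≢ σ v → v ⟶ w → w ⊑ v ⊎ v ⊑ w
  arc⇒nested σw≢σv vw with arc⇒⊑-or-obstruction σw≢σv vw
  ... | inj₁ w⊑v = inj₁ w⊑v
  ... | inj₂ obstruction-wv with arc⇒⊑-or-obstruction (≢-sym σw≢σv) (proj₁ obstruction-wv)
  ...   | inj₁ v⊑w = inj₂ v⊑w
  ...   | inj₂ obstruction-vw = ⊥-elim (no-mutual-obstruction obstruction-wv obstruction-vw)

  clusters-nested : ∀ {w v t} → InCluster w t → InCluster v t → w ⊑ v ⊎ v ⊑ w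
  clusters-nested {w} {v} wt vt with σ w Bool.≟ σ v
  ... | yes same = nested-sameColour same wt vt
  ... | no σw≢σv with crossColour-adjacent σw≢σv wt vt
  ...   | inj₁ wv = Sum.swap (arc⇒nested (≢-sym σw≢σv) wv)
  ...   | inj₂ vw = arc⇒nested σw≢σv vw

  C : V → Subset (suc n)
  C w = ⟦ inCluster? w ⟧

  ⊑⇒⊆ : ∀ {w v} → w ⊑ v → C w ⊆ C v
  ⊑⇒⊆ {w} {v} w⊑v z∈w = ∈⟦⟧⁺ (inCluster? v) (w⊑v _ (∈⟦⟧⁻ (inCluster? w) z∈w))

  data Cluster : Subset (suc n) → Set where
    whole     : Cluster ⊤
    singleton : ∀ x → Cluster ⁅ x ⁆
    around    : ∀ w → NonSink w → Cluster (C w)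

  clusters : List (Subset (suc n))
  clusters = ⊤ ∷ map ⁅_⁆ (allFin (suc n)) ++ map C (filter nonSink? (allFin (suc n)))

  around∈clusters : ∀ {w} → NonSink w → C w ∈ᴸ clusters
  around∈clusters {w} ns =
    there (∈-++⁺ʳ (map ⁅_⁆ (allFin (suc n))) (∈-map⁺ C (∈-filter⁺ nonSink? (∈-allFin w) ns)))

  clusters⇒Cluster : ∀ {S} → S ∈ᴸ clusters → Cluster S
  clusters⇒Cluster (here refl) = whole
  clusters⇒Cluster (there S∈) with ∈-++⁻ (map ⁅_⁆ (allFin (suc n))) S∈
  ... | inj₁ S∈⁅⁆ with ∈-map⁻ ⁅_⁆ {xs = allFin (suc n)} S∈⁅⁆
  ...   | x , _ , refl = singleton x
  clusters⇒Cluster (there S∈) | inj₂ S∈C with ∈-map⁻ C {xs = filter nonSink? (allFin (suc n))} S∈C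
  ...   | w , w∈ , refl = around w (proj₂ (∈-filter⁻ nonSink? w∈))

  Cluster-nonempty : ∀ {S} → Cluster S → Nonempty S
  Cluster-nonempty whole         = zero , ∈⊤
  Cluster-nonempty (singleton x) = x , x∈⁅x⁆ x
  Cluster-nonempty (around w ns) = w , ∈⟦⟧⁺ (inCluster? w) (self∈C ns)

  Cluster-nested : ∀ {S T x} → Cluster S → Cluster T → x ∈ S → x ∈ T → S ⊆ T ⊎ T ⊆ S
  Cluster-nested whole         _             _   _   = inj₂ (λ _ → ∈⊤)
  Cluster-nested _             whole         _   _   = inj₁ (λ _ → ∈⊤)
  Cluster-nested (singleton _) _             x∈S x∈T = inj₁ (∈⁅⁆⇒⊆ x∈S x∈T)
  Cluster-nested _             (singleton _) x∈S x∈T = inj₂ (∈⁅⁆⇒⊆ x∈T x∈S)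
  Cluster-nested (around w _)  (around v _)  x∈S x∈T =
    Sum.map ⊑⇒⊆ ⊑⇒⊆ (clusters-nested (∈⟦⟧⁻ (inCluster? w) x∈S) (∈⟦⟧⁻ (inCluster? v) x∈T))

  isHierarchy : IsHierarchy clusters
  isHierarchy = record
    { ⊤∈H      = here refl
    ; ⁅⁆∈H     = λ x → there (∈-++⁺ˡ (∈-map⁺ ⁅_⁆ (∈-allFin x)))
    ; nonempty = Cluster-nonempty ∘ clusters⇒Cluster
    ; nested   = λ S∈ T∈ → Cluster-nested (clusters⇒Cluster S∈) (clusters⇒Cluster T∈)
    }

  open HasseTree isHierarchy

  truncation : V → Bool → Fin size
  truncation x s with nonSink? x | s Bool.≟ σ x
  ... | yes _ | no _  = rootᴴ
  ... | yes _ | yes _ = leaf x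
  ... | no _  | _     = leaf x

  truncation-own : ∀ x → truncation x (σ x) ≡ leaf x
  truncation-own x with nonSink? x | σ x Bool.≟ σ x
  ... | yes _ | no σx≢σx = ⊥-elim (σx≢σx refl)
  ... | yes _ | yes _    = refl
  ... | no _  | _        = refl

  truncation-other : ∀ {x s} → NonSink x → s ≢ σ x → truncation x s ≡ rootᴴ
  truncation-other {x} {s} ns s≢σx with nonSink? x | s Bool.≟ σ x
  ... | yes _ | no _    = refl
  ... | yes _ | yes s≡σx = ⊥-elim (s≢σx s≡σx)
  ... | no ¬ns | _      = ⊥-elim (¬ns ns)

  truncation-sink : ∀ {x s} → ¬ NonSink x → truncation x s ≡ leaf x
  truncation-sink {x} {s} ¬ns with nonSink? x | s Bool.≟ σ x
  ... | yes ns | _    = ⊥-elim (¬ns ns)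
  ... | no _   | _    = refl

  leaf≼truncation : ∀ x s → leaf x ≼ truncation x s
  leaf≼truncation x s with nonSink? x | s Bool.≟ σ x
  ... | yes _ | no _  = ≼-root (leaf x)
  ... | yes _ | yes _ = 0 , refl
  ... | no _  | _     = 0 , refl

  isTruncationMap : TruncationMap tree leaf σ truncation
  isTruncationMap = leaf≼truncation , truncation-own

  arc∈Cluster : ∀ {x y y′ S} → x ⟶ y → σ y′ ≡ σ y → Cluster S → x ∈ S → y′ ∈ S → y ∈ S
  arc∈Cluster _  _    whole          _   _    = ∈⊤
  arc∈Cluster {x} {y} xy same (singleton z) x∈S y′∈S =
    ⊥-elim (proper x y xy (trans (cong σ (trans (x∈⁅y⁆⇒x≡y z x∈S) (sym (x∈⁅y⁆⇒x≡y z y′∈S)))) same))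
  arc∈Cluster xy _    (around w _)   x∈S _    =
    ∈⟦⟧⁺ (inCluster? w) (C-closed (∈⟦⟧⁻ (inCluster? w) x∈S) xy)

  arc⇒quasiBestMatch : ∀ {x y} → x ⟶ y → QuasiBestMatch tree leaf σ truncation x y
  arc⇒quasiBestMatch {x} {y} xy = (proper x y xy , best) , λ a _ →
    subst (a ≼_) (sym (truncation-other (y , xy) (≢-sym (proper x y xy)))) (≼-root a)
    where
    best : ∀ y′ → σ y′ ≡ σ y → ∀ a b →
           IsLCA tree (leaf x) (leaf y) a → IsLCA tree (leaf x) (leaf y′) b → a ≼ b
    best y′ same a b (_ , _ , a-least) (x≼b , y′≼b , _) = a-least b x≼b (∈⇒leaf≼
      (arc∈Cluster xy same (clusters⇒Cluster (cluster∈H b)) (leaf≼⇒∈ x≼b) (leaf≼⇒∈ y′≼b)))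

  sink⇒¬quasiBestMatch : ∀ {x y} → ¬ NonSink x → ¬ QuasiBestMatch tree leaf σ truncation x y
  sink⇒¬quasiBestMatch {x} {y} sink ((σx≢σy , _) , truncated) =
    σx≢σy (cong σ (sym (∈leaf⇒≡ (≼⇒⊆ a≼x (leaf≼⇒∈ y≼a)))))
    where
    a : Fin size
    a = proj₁ (lca-exists x y)
    lca-a : IsLCA tree (leaf x) (leaf y) a
    lca-a = proj₂ (lca-exists x y)
    y≼a : leaf y ≼ a
    y≼a = proj₁ (proj₂ lca-a)
    a≼x : a ≼ leaf x
    a≼x = subst (a ≼_) (truncation-sink sink) (truncated a lca-a)

  nonSink-quasiBestMatch⇒arc : ∀ {x y} → NonSink x → QuasiBestMatch tree leaf σ truncation x y → x ⟶ y
  nonSink-quasiBestMatch⇒arc {x} {y} (y₀ , xy₀) ((σx≢σy , best) , _) =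
    C⇒arc (∈⟦⟧⁻ (inCluster? x) y∈Cx) (≢-sym σx≢σy)
    where
    c : Fin size
    c = proj₁ (vertex (around∈clusters (y₀ , xy₀)))
    c≡Cx : cluster c ≡ C x
    c≡Cx = proj₂ (vertex (around∈clusters (y₀ , xy₀)))
    ∈c : ∀ {z} → InCluster x z → z ∈ cluster c
    ∈c z∈Cx = subst (_ ∈_) (sym c≡Cx) (∈⟦⟧⁺ (inCluster? x) z∈Cx)
    a : Fin size
    a = proj₁ (lca-exists x y)
    lca-a : IsLCA tree (leaf x) (leaf y) a
    lca-a = proj₂ (lca-exists x y)
    b : Fin size
    b = proj₁ (lca-exists x y₀)
    lca-b : IsLCA tree (leaf x) (leaf y₀) b
    lca-b = proj₂ (lca-exists x y₀)
    a≼b : a ≼ b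
    a≼b = best y₀ (≢-≢⇒≡ σx≢σy (≢-sym (proper x y₀ xy₀))) a b lca-a lca-b
    b≼c : b ≼ c
    b≼c = proj₂ (proj₂ lca-b) c (∈⇒leaf≼ (∈c (self∈C (y₀ , xy₀)))) (∈⇒leaf≼ (∈c (inj₁ xy₀)))
    y∈Cx : y ∈ C x
    y∈Cx = subst (y ∈_) c≡Cx (≼⇒⊆ b≼c (≼⇒⊆ a≼b (leaf≼⇒∈ (proj₁ (proj₂ lca-a)))))

  quasiBestMatch⇒arc : ∀ {x y} → QuasiBestMatch tree leaf σ truncation x y → x ⟶ y
  quasiBestMatch⇒arc {x} qbm =
    Sum.[ (λ ns → nonSink-quasiBestMatch⇒arc ns qbm)
        , (λ sink → ⊥-elim (sink⇒¬quasiBestMatch sink qbm)) ]′ (toSum (nonSink? x))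

  isQBMG : IsQBMG G σ
  isQBMG = tree , phylogenetic , leaf , leafLabelling , truncation , isTruncationMap ,
           λ x y → arc⇒quasiBestMatch , quasiBestMatch⇒arc

corollary7 : (n : ℕ) (G : Digraph (suc n)) → N1 G → N2 G → N3 G →
    (σ : Fin (suc n) → Bool) → Proper2Coloring G σ → IsQBMG G σ
corollary7 n G n1 n2 n3 σ proper = ClusterTree.isQBMG G n1 n2 n3 σ proper
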